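{- Let $T$ be a tree with $\operatorname{diam}(T)=4$, let $L$ be its set of leaves and $s$ its number of support vertices. Then $\chi_d^t(T)=s+1$ if $d(u,u')=3$ for some leaves $u,u'\in L$, and $\chi_d^t(T)=s+2$ otherwise.
   Context: $d(u,v)$ is the distance (length of a shortest path) between $u$ and $v$, and $\operatorname{diam}(T)$ is the maximum distance between two vertices. In a tree, a leaf is a vertex of degree one, and a support vertex is a neighbor of a leaf that has degree more than one. A total dominator coloring of a graph $G$ is a proper vertex coloring of $G$ in which each vertex of $G$ is adjacent to every vertex of some color class; $\chi_d^t(G)$ is the minimum number of color classes in a total dominator coloring of $G$. -}

module Defs where

open import Data.Nat using (ℕ; zero; suc; _≤_; _<_; _≡ᵇ_; _<ᵇ_)
open import Data.Fin using (Fin; zero; suc; inject₁; fromℕ)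
open import Data.Bool using (Bool; true; false; _∧_)
open import Data.List using (List; length; filter; allFin)
open import Data.Bool.ListAction using (any)
open import Data.Product using (Σ; ∃; ∃-syntax; _×_; _,_)
open import Relation.Binary.PropositionalEquality using (_≡_; _≢_)
open import Relation.Nullary using (¬_)
open import Data.Bool.Properties using (T?)
open import Function.Definitions using (Injective; Surjective)

record Graph (n : ℕ) : Set where
  field
    Adj   : Fin n → Fin n → Bool
    sym   : ∀ u v → Adj u v ≡ Adj v u
    irrfl : ∀ v → Adj v v ≡ false
open Graph public

module _ {n : ℕ} (G : Graph n) where

  data Walk : Fin n → Fin n → ℕ → Set where
    here : ∀ {v} → Walk v v zero
    step : ∀ {u w v k} → Adj G u w ≡ true → Walk w v k → Walk u v (suc k)

  Connected : Set
  Connected = ∀ u v → ∃[ k ] Walk u v k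

  -- a cycle: m+3 pairwise distinct vertices, cyclically consecutive ones adjacent
  HasCycle : Set
  HasCycle = ∃[ m ] Σ (Fin (suc (suc (suc m))) → Fin n) λ f →
      Injective _≡_ _≡_ f
    × (∀ (i : Fin (suc (suc m))) → Adj G (f (inject₁ i)) (f (suc i)) ≡ true)
    × Adj G (f (fromℕ (suc (suc m)))) (f zero) ≡ true

  IsTree : Set
  IsTree = Connected × ¬ HasCycle

  Dist : Fin n → Fin n → ℕ → Set
  Dist u v k = Walk u v k × (∀ j → Walk u v j → k ≤ j)

  Diam : ℕ → Set
  Diam k = (∀ u v → ∃[ j ] (Dist u v j × j ≤ k)) × (∃[ u ] ∃[ v ] Dist u v k)

  degree : Fin n → ℕ
  degree v = length (filter (λ w → T? (Adj G v w)) (allFin n))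

  IsLeaf : Fin n → Set
  IsLeaf v = degree v ≡ 1

  isSupport : Fin n → Bool
  isSupport v = (1 <ᵇ degree v) ∧ any (λ w → Adj G v w ∧ (degree w ≡ᵇ 1)) (allFin n)

  supportCount : ℕ
  supportCount = length (filter (λ v → T? (isSupport v)) (allFin n))

  -- total dominator coloring with exactly k (nonempty) color classes
  IsTDC : (k : ℕ) → (Fin n → Fin k) → Set
  IsTDC k c = Surjective _≡_ _≡_ c
            × (∀ u v → Adj G u v ≡ true → c u ≢ c v)
            × (∀ v → ∃[ i ] (∀ w → c w ≡ i → Adj G v w ≡ true))

  HasTDC : ℕ → Set
  HasTDC k = Σ (Fin n → Fin k) (IsTDC k)

  TDChromatic : ℕ → Set
  TDChromatic m = HasTDC m × (∀ k → HasTDC k → m ≤ k)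

module Submission where

-- Fix a diametral path a – x₁ – c – x₂ – b and measure levels as distances to the centre c. Every
-- level is at most 2, so the level-two vertices are leaves hanging from level one, the support vertices
-- are c (if some leaf hangs from c) and the level-one vertices with children, and two leaves lie at
-- distance 3 exactly when c is a support vertex. In any total dominator colouring each support vertex
-- is alone in its class (its leaf dominates a class inside the leaf's single neighbourhood), so the s
-- support classes come on top of every colour not carried by a support vertex. Giving each support vertex
-- its own colour, one more colour suffices when c is a support vertex; otherwise c needs a class of its
-- own, dominated by the level-one vertices, and the classes dominated by x₁ and x₂ force two extra colours.

open import Defs hiding (sym)
open import Data.Nat using (ℕ; zero; suc; _+_; _≤_; _<_; z≤n; s≤s; _≤?_; >-nonZero⁻¹)
open import Data.Nat.Properties
  using (≤-antisym; ≤-trans; ≤-refl; ≤-reflexive; <-irrefl; n≤0⇒n≡0; m≤n⇒m≤1+n; n≤1+n; <-cmp; ≤-pred;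
         +-cancelˡ-<; +-cancelˡ-≤; +-cancelʳ-≤; +-monoˡ-≤; <-≤-trans; ≰⇒>; ≤∧≢⇒<; suc-injective; 0≢1+n;
         1+n≢n; <ᵇ⇒<; <⇒<ᵇ; ≡ᵇ⇒≡; ≡⇒≡ᵇ)
open import Data.Fin using (Fin; zero; suc; inject₁; fromℕ; _≟_; _↑ˡ_; _↑ʳ_; splitAt; join)
open import Data.Fin.Properties
  using (injective⇒≤; nonZeroIndex; join-splitAt; ↑ˡ-injective; ↑ʳ-injective; splitAt-↑ˡ; splitAt-↑ʳ)
open import Data.Bool using (Bool; true; false)
open import Data.Bool.Properties using (T-≡; T-∧)
open import Data.List using (List; length; filter; allFin; lookup)
open import Data.List.Membership.Propositional using (_∈_)
open import Data.List.Membership.Propositional.Properties using (∈-filter⁺; ∈-filter⁻; ∈-allFin; ∈-lookup)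
import Data.List.Relation.Unary.All as All
import Data.List.Relation.Unary.Any as Any
open import Data.List.Relation.Unary.Any using (here; there; index)
open import Data.List.Relation.Unary.Any.Properties using (lookup-index; any⁺; any⁻)
open import Data.List.Relation.Unary.AllPairs using (_∷_)
open import Data.List.Relation.Unary.Unique.Propositional using (Unique)
open import Data.List.Relation.Unary.Unique.Propositional.Properties using (filter⁺; allFin⁺)
open import Data.Product using (Σ; ∃-syntax; _×_; _,_; proj₁; proj₂)
open import Data.Sum using (_⊎_; inj₁; inj₂; [_,_]′)
open import Data.Unit using (⊤; tt)
open import Data.Empty using (⊥; ⊥-elim)
open import Function.Base using (_∘_)
open import Function.Bundles using (Equivalence)
open import Function.Consequences.Propositional using (strictlySurjective⇒surjective)
open import Function.Definitions using (Injective)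
open import Relation.Binary.Definitions using (tri<; tri≈; tri>)
open import Relation.Binary.PropositionalEquality using (_≡_; _≢_; refl; sym; trans; cong; subst)
open import Relation.Nullary using (¬_; yes; no)
open import Relation.Nullary.Decidable using (T?)

index-of-lookup : ∀ {A : Set} {xs : List A} {x} → Unique xs → (x∈xs : x ∈ xs) →
                  ∀ i → lookup xs i ≡ x → index x∈xs ≡ i
index-of-lookup _ (here refl) zero _ = refl
index-of-lookup (x∉xs ∷ _) (here refl) (suc i) e = ⊥-elim (All.lookup x∉xs (∈-lookup i) (sym e))
index-of-lookup (x∉xs ∷ _) (there x∈xs) zero refl = ⊥-elim (All.lookup x∉xs x∈xs refl)
index-of-lookup (_ ∷ unique) (there x∈xs) (suc i) e = cong suc (index-of-lookup unique x∈xs i e)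

disjoint-injections : ∀ {a b m} {f : Fin a → Fin m} {g : Fin b → Fin m} →
  Injective _≡_ _≡_ f → Injective _≡_ _≡_ g → (∀ i j → f i ≢ g j) → a + b ≤ m
disjoint-injections {a} {b} {f = f} {g} f-inj g-inj disjoint =
  injective⇒≤ {f = λ y → [ f , g ]′ (splitAt a y)} (λ q → splitAt-injective (copair-injective q))
  where
  copair-injective : Injective _≡_ _≡_ [ f , g ]′
  copair-injective {inj₁ i} {inj₁ i'} q = cong inj₁ (f-inj q)
  copair-injective {inj₁ i} {inj₂ j'} q = ⊥-elim (disjoint i j' q)
  copair-injective {inj₂ j} {inj₁ i'} q = ⊥-elim (disjoint i' j (sym q))
  copair-injective {inj₂ j} {inj₂ j'} q = cong inj₂ (g-inj q)
  splitAt-injective : Injective _≡_ _≡_ (splitAt a {b})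
  splitAt-injective {y} {y'} q =
    trans (sym (join-splitAt a b y)) (trans (cong (join a b) q) (join-splitAt a b y'))

pair : ∀ {m} → Fin m → Fin m → Fin 2 → Fin m
pair i _ zero = i
pair _ j (suc zero) = j

pair-injective : ∀ {m} {i j : Fin m} → i ≢ j → Injective _≡_ _≡_ (pair i j)
pair-injective _ {zero} {zero} _ = refl
pair-injective i≢j {zero} {suc zero} q = ⊥-elim (i≢j q)
pair-injective i≢j {suc zero} {zero} q = ⊥-elim (i≢j (sym q))
pair-injective _ {suc zero} {suc zero} _ = refl

module Enumeration {n : ℕ} (P : Fin n → Bool) where

  members : List (Fin n)
  members = filter (λ v → T? (P v)) (allFin n)

  count : ℕ
  count = length members

  private
    members-unique : Unique members
    members-unique = filter⁺ (λ v → T? (P v)) (allFin⁺ n)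

    membership : ∀ {v} → P v ≡ true → v ∈ members
    membership e = ∈-filter⁺ (λ v → T? (P v)) (∈-allFin _) (Equivalence.from T-≡ e)

  rank : ∀ {v} → P v ≡ true → Fin count
  rank e = index (membership e)

  element : Fin count → Fin n
  element = lookup members

  element-holds : ∀ i → P (element i) ≡ true
  element-holds i =
    Equivalence.to T-≡ (proj₂ (∈-filter⁻ (λ v → T? (P v)) {xs = allFin n} (∈-lookup i)))

  element-rank : ∀ {v} (e : P v ≡ true) → element (rank e) ≡ v
  element-rank e = sym (lookup-index (membership e))

  rank-element : ∀ {v} (e : P v ≡ true) i → element i ≡ v → rank e ≡ i
  rank-element e = index-of-lookup members-unique (membership e)

  rank-injective : ∀ {v w} (e : P v ≡ true) (e' : P w ≡ true) → rank e ≡ rank e' → v ≡ w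
  rank-injective e e' q = trans (sym (element-rank e)) (trans (cong element q) (element-rank e'))

  element-injective : Injective _≡_ _≡_ element
  element-injective {i} {j} q =
    trans (sym (rank-element (element-holds j) i q)) (rank-element (element-holds j) j refl)

  count-≥1 : ∀ {x} → P x ≡ true → 1 ≤ count
  count-≥1 e = >-nonZero⁻¹ count {{nonZeroIndex (rank e)}}

  count-≥2 : ∀ {x y} → P x ≡ true → P y ≡ true → x ≢ y → 2 ≤ count
  count-≥2 ex ey x≢y = injective⇒≤ (pair-injective (λ q → x≢y (rank-injective ex ey q)))

  count-≡1 : ∀ {p} → P p ≡ true → (∀ w → P w ≡ true → w ≡ p) → count ≡ 1
  count-≡1 ep only = ≤-antisym (injective⇒≤ {f = λ _ → zero} collapse) (count-≥1 ep)
    where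
    collapse : Injective _≡_ _≡_ (λ (_ : Fin count) → zero {0})
    collapse {i} {j} _ = element-injective
      (trans (only _ (element-holds i)) (sym (only _ (element-holds j))))

module Walks {n : ℕ} (G : Graph n) where

  infix 4 _~_
  _~_ : Fin n → Fin n → Set
  u ~ v = Adj G u v ≡ true

  ~-sym : ∀ {u v} → u ~ v → v ~ u
  ~-sym {u} {v} u~v = trans (Graph.sym G v u) u~v

  ~-irrefl : ∀ {u v} → u ~ v → u ≢ v
  ~-irrefl {u} u~u refl with trans (sym u~u) (irrfl G u)
  ... | ()

  snoc : ∀ {u v w k} → Walk G u v k → v ~ w → Walk G u w (suc k)
  snoc here v~w = step v~w here
  snoc (step h p) v~w = step h (snoc p v~w)

  reverse : ∀ {u v k} → Walk G u v k → Walk G v u k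
  reverse here = here
  reverse (step h p) = snoc (reverse p) (~-sym h)

  infixr 5 _++ʷ_
  _++ʷ_ : ∀ {u v w k j} → Walk G u v k → Walk G v w j → Walk G u w (k + j)
  here ++ʷ q = q
  step h p ++ʷ q = step h (p ++ʷ q)

  walk-zero : ∀ {u v} → Walk G u v 0 → u ≡ v
  walk-zero here = refl

  Along : ∀ {u v k} → (Fin n → Set) → Walk G u v k → Set
  Along P (here {v}) = P v
  Along P (step {u} _ p) = P u × Along P p

  along-map : ∀ {P Q : Fin n → Set} {u v k} → (∀ {x} → P x → Q x) →
              (p : Walk G u v k) → Along P p → Along Q p
  along-map f here Pv = f Pv
  along-map f (step _ p) (Pu , Pp) = f Pu , along-map f p Pp

  along-snoc : ∀ {P : Fin n → Set} {u v w k} (p : Walk G u v k) (v~w : v ~ w) →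
               Along P p → P w → Along P (snoc p v~w)
  along-snoc here _ Pv Pw = Pv , Pw
  along-snoc (step _ p) v~w (Pu , Pp) Pw = Pu , along-snoc p v~w Pp Pw

  along-reverse : ∀ {P : Fin n → Set} {u v k} (p : Walk G u v k) → Along P p → Along P (reverse p)
  along-reverse here Pv = Pv
  along-reverse (step _ p) (Pu , Pp) = along-snoc (reverse p) _ (along-reverse p Pp) Pu

  along-++ : ∀ {P : Fin n → Set} {u v w k j} (p : Walk G u v k) (q : Walk G v w j) →
             Along P p → Along P q → Along P (p ++ʷ q)
  along-++ here q _ Pq = Pq
  along-++ (step _ p) q (Pu , Pp) Pq = Pu , along-++ p q Pp Pq

  Simple : ∀ {u v k} → Walk G u v k → Set
  Simple here = ⊤
  Simple (step {u} _ p) = Along (u ≢_) p × Simple p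

  _⊑_ : ∀ {u v k u' v' k'} → Walk G u v k → Walk G u' v' k' → Set₁
  p ⊑ q = ∀ {P} → Along P q → Along P p

  suffix-from : ∀ {u v k} (x : Fin n) (w : Walk G u v k) →
    Along (x ≢_) w ⊎ (∃[ j ] Σ (Walk G x v j) λ d → (Simple w → Simple d) × d ⊑ w)
  suffix-from x (here {v}) with x ≟ v
  ... | yes refl = inj₂ (0 , here , (λ _ → tt) , λ Pw → Pw)
  ... | no x≢v = inj₁ x≢v
  suffix-from x (step {u} h w) with x ≟ u
  ... | yes refl = inj₂ (_ , step h w , (λ s → s) , λ Pw → Pw)
  ... | no x≢u with suffix-from x w
  ...   | inj₁ avoids = inj₁ (x≢u , avoids)
  ...   | inj₂ (j , d , simple , d⊑w) = inj₂ (j , d , (λ s → simple (proj₂ s)) , λ Pw → d⊑w (proj₂ Pw))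

  erase-loops : ∀ {u v k} (w : Walk G u v k) → ∃[ j ] Σ (Walk G u v j) λ d → Simple d × d ⊑ w
  erase-loops here = 0 , here , tt , λ Pw → Pw
  erase-loops (step {u} h w) with erase-loops w
  ... | (j , d , simple , d⊑w) with suffix-from u d
  ...   | inj₁ avoids = suc j , step h d , (avoids , simple) , λ { (Pu , Pw) → Pu , d⊑w Pw }
  ...   | inj₂ (i , d' , simple' , d'⊑d) = i , d' , simple' simple , λ Pw → d'⊑d (d⊑w (proj₂ Pw))

  vertex : ∀ {u v k} → Walk G u v k → Fin (suc k) → Fin n
  vertex {u} _ zero = u
  vertex (step _ p) (suc i) = vertex p i

  along-vertex : ∀ {P : Fin n → Set} {u v k} (p : Walk G u v k) → Along P p → ∀ i → P (vertex p i)
  along-vertex here Pv zero = Pv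
  along-vertex (step _ p) (Pu , _) zero = Pu
  along-vertex (step _ p) (_ , Pp) (suc i) = along-vertex p Pp i

  simple-injective : ∀ {u v k} (p : Walk G u v k) → Simple p → Injective _≡_ _≡_ (vertex p)
  simple-injective here _ {zero} {zero} _ = refl
  simple-injective (step _ p) _ {zero} {zero} _ = refl
  simple-injective (step _ p) (fresh , _) {zero} {suc j} e = ⊥-elim (along-vertex p fresh j e)
  simple-injective (step _ p) (fresh , _) {suc i} {zero} e = ⊥-elim (along-vertex p fresh i (sym e))
  simple-injective (step _ p) (_ , simple) {suc i} {suc j} e = cong suc (simple-injective p simple e)

  vertex-adjacent : ∀ {u v k} (p : Walk G u v (suc k)) (i : Fin (suc k)) →
                    vertex p (inject₁ i) ~ vertex p (suc i)
  vertex-adjacent (step h here) zero = h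
  vertex-adjacent (step h (step _ _)) zero = h
  vertex-adjacent (step _ (step h p)) (suc i) = vertex-adjacent (step h p) i

  vertex-last : ∀ {u v k} (p : Walk G u v k) → vertex p (fromℕ k) ≡ v
  vertex-last here = refl
  vertex-last (step _ p) = vertex-last p

  close-cycle : ∀ {v p q m} → v ~ p → q ~ v → (w : Walk G p q (suc m)) →
                Simple w → Along (v ≢_) w → HasCycle G
  close-cycle {m = m} v~p q~v w simple avoids =
    m , vertex cyc , simple-injective cyc (avoids , simple) , vertex-adjacent cyc ,
    subst (λ z → z ~ _) (sym (vertex-last cyc)) q~v
    where cyc = step v~p w

  no-detour : ¬ HasCycle G → ∀ {v p q k} → v ~ p → v ~ q → p ≢ q →
              (w : Walk G p q k) → ¬ Along (v ≢_) w
  no-detour acyclic v~p v~q p≢q w avoids with erase-loops w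
  ... | (zero , d , _ , _) = p≢q (walk-zero d)
  ... | (suc _ , d , simple , d⊑w) = acyclic (close-cycle v~p (~-sym v~q) d simple (d⊑w avoids))

module Levels {n : ℕ} (G : Graph n) (acyclic : ¬ HasCycle G) (root : Fin n)
              (toRoot : ∀ v → ∃[ j ] Dist G v root j) where
  open Walks G

  level : Fin n → ℕ
  level v = proj₁ (toRoot v)

  geodesic : ∀ v → Walk G v root (level v)
  geodesic v = proj₁ (proj₂ (toRoot v))

  level-minimal : ∀ {v j} → Walk G v root j → level v ≤ j
  level-minimal {v} {j} w = proj₂ (proj₂ (toRoot v)) j w

  level-step : ∀ {u v} → u ~ v → level u ≤ suc (level v)
  level-step u~v = level-minimal (step u~v (geodesic _))

  level-root : level root ≡ 0
  level-root = n≤0⇒n≡0 (level-minimal here)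

  level-zero : ∀ {v} → level v ≡ 0 → v ≡ root
  level-zero {v} e = walk-zero (subst (Walk G v root) e (geodesic v))

  root-≢ : ∀ {v k} → level v ≡ suc k → root ≢ v
  root-≢ e refl = 0≢1+n (trans (sym level-root) e)

  -- A vertex at level k + 1 has a neighbour (its parent) at level k: the next vertex of a geodesic.
  parent : ∀ {v k} → level v ≡ suc k → ∃[ p ] (v ~ p × level p ≡ k)
  parent {v} e = next (subst (Walk G v root) e (geodesic v)) e
    where
    next : ∀ {k} → Walk G v root (suc k) → level v ≡ suc k → ∃[ p ] (v ~ p × level p ≡ k)
    next (step {w = p} v~p w) e' =
      p , v~p , ≤-antisym (level-minimal w) (≤-pred (subst (_≤ suc (level p)) e' (level-step v~p)))

  along-to-root : ∀ {x k} (w : Walk G x root k) → Along (λ y → level y ≤ k) w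
  along-to-root here = ≤-reflexive level-root
  along-to-root (step h w) = level-minimal (step h w) , along-map m≤n⇒m≤1+n w (along-to-root w)

  avoids : ∀ {x k v} (w : Walk G x root k) → k ≤ level v → x ≢ v → Along (v ≢_) w
  avoids here _ x≢v = λ e → x≢v (sym e)
  avoids (step h w) k≤lv x≢v = (λ e → x≢v (sym e)) ,
    along-map (λ ly e → <-irrefl refl (≤-trans k≤lv (subst (λ z → level z ≤ _) (sym e) ly)))
              w (along-to-root w)

  -- At most one neighbour of v has level ≤ level v; otherwise their geodesics close a cycle.
  low-neighbour-unique : ∀ {v p q} → v ~ p → v ~ q → level p ≤ level v → level q ≤ level v → p ≡ q
  low-neighbour-unique {v} {p} {q} v~p v~q lp lq with p ≟ q
  ... | yes p≡q = p≡q
  ... | no p≢q = ⊥-elim (no-detour acyclic v~p v~q p≢q (geodesic p ++ʷ reverse (geodesic q))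
          (along-++ (geodesic p) _ (avoids (geodesic p) lp (λ e → ~-irrefl v~p (sym e)))
                    (along-reverse (geodesic q) (avoids (geodesic q) lq (λ e → ~-irrefl v~q (sym e))))))

  neighbour-level : ∀ {u v} → u ~ v → level u ≡ suc (level v) ⊎ level v ≡ suc (level u)
  neighbour-level {u} {v} u~v with <-cmp (level u) (level v)
  ... | tri< lu<lv _ _ = inj₂ (≤-antisym (level-step (~-sym u~v)) lu<lv)
  ... | tri> _ _ lv<lu = inj₁ (≤-antisym (level-step u~v) lv<lu)
  ... | tri≈ _ lu≡lv _ = ⊥-elim (same-level lu≡lv)
    where
    same-level : level u ≡ level v → ⊥
    same-level e with level v in ev
    ... | zero = ~-irrefl u~v (trans (level-zero e) (sym (level-zero ev)))
    ... | suc k with parent ev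
    ...   | (p , v~p , lp) = <-irrefl (sym (trans (sym e) (trans (cong level (sym p≡u)) lp))) ≤-refl
      where
      p≡u : p ≡ u
      p≡u = low-neighbour-unique v~p (~-sym u~v)
              (subst (level p ≤_) (sym ev) (≤-trans (≤-reflexive lp) (n≤1+n k)))
              (subst (level u ≤_) (sym ev) (≤-reflexive e))

  -- A walk from x to y through the root has length at least level x + level y.
  starts-off-root : ∀ {x y k} → Walk G x y k → k < level x + level y → root ≢ x
  starts-off-root {y = y} w short refl = <-irrefl refl
    (≤-trans short (subst (λ t → t + level y ≤ _) (sym level-root) (level-minimal (reverse w))))

  avoids-root : ∀ {x y k} (w : Walk G x y k) → k < level x + level y → Along (root ≢_) w
  avoids-root here short = starts-off-root here short
  avoids-root {y = y} (step {w = z} {k = k} x~z w) short = starts-off-root (step x~z w) short ,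
    avoids-root w (+-cancelˡ-< 1 k (level z + level y) (≤-trans short (+-monoˡ-≤ (level y) (level-step x~z))))

true-and-false : ∀ {b} → b ≡ true → b ≡ false → ⊥
true-and-false refl ()

↑ˡ≢↑ʳ : ∀ {a b} {i : Fin a} {j : Fin b} → i ↑ˡ b ≢ a ↑ʳ j
↑ˡ≢↑ʳ {a} {b} {i} {j} q with trans (sym (splitAt-↑ˡ a i b)) (trans (cong (splitAt a) q) (splitAt-↑ʳ a b j))
... | ()

module Supports {n : ℕ} (G : Graph n) where
  open Walks G

  degree-≥1 : ∀ {v x} → v ~ x → 1 ≤ degree G v
  degree-≥1 {v} = Enumeration.count-≥1 (Adj G v)

  degree-≥2 : ∀ {v x y} → v ~ x → v ~ y → x ≢ y → 2 ≤ degree G v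
  degree-≥2 {v} = Enumeration.count-≥2 (Adj G v)

  only-neighbour⇒leaf : ∀ {v p} → v ~ p → (∀ w → v ~ w → w ≡ p) → IsLeaf G v
  only-neighbour⇒leaf {v} = Enumeration.count-≡1 (Adj G v)

  branching-not-leaf : ∀ {v} → 2 ≤ degree G v → ¬ IsLeaf G v
  branching-not-leaf two≤deg leaf with subst (2 ≤_) leaf two≤deg
  ... | s≤s ()

  leaf-neighbour-unique : ∀ {v x y} → IsLeaf G v → v ~ x → v ~ y → x ≡ y
  leaf-neighbour-unique {x = x} {y} leaf v~x v~y with x ≟ y
  ... | yes x≡y = x≡y
  ... | no x≢y = ⊥-elim (branching-not-leaf (degree-≥2 v~x v~y x≢y) leaf)

  support⇒ : ∀ {v} → isSupport G v ≡ true → 1 < degree G v × ∃[ w ] (v ~ w × IsLeaf G w)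
  support⇒ {v} e =
    let big , some = Equivalence.to T-∧ (Equivalence.from T-≡ e)
        w , adjacent-leaf = Any.satisfied (any⁻ _ (allFin n) some)
        adjacent , leaf = Equivalence.to T-∧ adjacent-leaf
    in <ᵇ⇒< 1 (degree G v) big , w , Equivalence.to T-≡ adjacent , ≡ᵇ⇒≡ (degree G w) 1 leaf

  ⇒support : ∀ {v w} → 1 < degree G v → v ~ w → IsLeaf G w → isSupport G v ≡ true
  ⇒support {v} {w} big v~w leaf = Equivalence.to T-≡ (Equivalence.from T-∧
    (<⇒<ᵇ big , any⁺ _ (Any.map (λ { refl → witness }) (∈-allFin w))))
    where
    witness = Equivalence.from T-∧ (Equivalence.from T-≡ v~w , ≡⇒≡ᵇ (degree G w) 1 leaf)

  leaf-not-support : ∀ {v} → IsLeaf G v → isSupport G v ≡ false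
  leaf-not-support leaf rewrite leaf = refl

module Colourings {n : ℕ} (G : Graph n) where
  open Walks G
  open Supports G
  open Enumeration (isSupport G) using (rank; element; element-holds; rank-element; rank-injective; element-injective)

  s : ℕ
  s = supportCount G

  module Lower {m : ℕ} {col : Fin n → Fin m} (tdc : IsTDC G m col) where

    -- A support vertex is alone in its colour class: its leaf dominates some class, and that class
    -- can only contain the leaf's unique neighbour.
    support-alone : ∀ {p w} → isSupport G p ≡ true → col w ≡ col p → w ≡ p
    support-alone sp q with support⇒ sp
    ... | _ , l , p~l , leaf with proj₂ (proj₂ tdc) l
    ...   | i , dominated with proj₁ tdc i
    ...     | w₀ , w₀∈i with leaf-neighbour-unique leaf (dominated w₀ (w₀∈i refl)) (~-sym p~l)
    ...       | refl = leaf-neighbour-unique leaf (dominated _ (trans q (w₀∈i refl))) (~-sym p~l)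

    Free : Fin m → Set
    Free i = ∀ v → isSupport G v ≡ true → i ≢ col v

    -- The colour of a non-support vertex is free: a support vertex shares its class with nobody.
    non-support-free : ∀ {v} → isSupport G v ≡ false → Free (col v)
    non-support-free nv p sp q with support-alone sp q
    ... | refl = true-and-false sp nv

    -- The s support classes are distinct, so k further distinct free colours give s + k ≤ m.
    lower-bound : ∀ {k} (extra : Fin k → Fin m) → Injective _≡_ _≡_ extra → (∀ j → Free (extra j)) → s + k ≤ m
    lower-bound extra extra-injective free =
      disjoint-injections {f = col ∘ element} support-colours-injective extra-injective
                          (λ i j q → free j _ (element-holds i) (sym q))
      where
      support-colours-injective : Injective _≡_ _≡_ (col ∘ element)
      support-colours-injective {i} {j} q = element-injective (support-alone (element-holds j) q)

  Dominated : ∀ {k} → (Fin n → Fin k) → Fin n → Set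
  Dominated ext v = (∃[ p ] (isSupport G p ≡ true × v ~ p))
                  ⊎ (∃[ j ] (∀ w → isSupport G w ≡ false → ext w ≡ j → v ~ w))

  module Upper {k : ℕ} (ext : Fin n → Fin k) where

    colour-by : ∀ v b → isSupport G v ≡ b → Fin (s + k)
    colour-by v true e = rank e ↑ˡ k
    colour-by v false _ = s ↑ʳ ext v

    colour : Fin n → Fin (s + k)
    colour v = colour-by v (isSupport G v) refl

    colour-view : ∀ v → (∃[ e ] colour v ≡ rank {v} e ↑ˡ k) ⊎ (isSupport G v ≡ false × colour v ≡ s ↑ʳ ext v)
    colour-view v = view (isSupport G v) refl
      where
      view : ∀ b (e : isSupport G v ≡ b) →
             (∃[ e' ] colour-by v b e ≡ rank {v} e' ↑ˡ k) ⊎ (isSupport G v ≡ false × colour-by v b e ≡ s ↑ʳ ext v)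
      view true e = inj₁ (e , refl)
      view false e = inj₂ (e , refl)

    colour-alone : ∀ {p w} → isSupport G p ≡ true → colour w ≡ colour p → w ≡ p
    colour-alone {p} {w} sp q with colour-view p | colour-view w
    ... | inj₂ (np , _) | _ = ⊥-elim (true-and-false sp np)
    ... | inj₁ (e , cp) | inj₁ (e' , cw) = rank-injective e' e (↑ˡ-injective k _ _ (trans (sym cw) (trans q cp)))
    ... | inj₁ (e , cp) | inj₂ (_ , cw) = ⊥-elim (↑ˡ≢↑ʳ (trans (sym cp) (trans (sym q) cw)))

    construction : (∀ j → ∃[ v ] (isSupport G v ≡ false × ext v ≡ j)) →
                   (∀ {u v} → u ~ v → isSupport G u ≡ false → isSupport G v ≡ false → ext u ≢ ext v) →
                   (∀ v → Dominated ext v) →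
                   HasTDC G (s + k)
    construction uses-all proper dominated = colour , strictlySurjective⇒surjective hit , distinct , dominates
      where
      hits : ∀ z → ∃[ v ] colour v ≡ join s k z
      hits (inj₁ i) with colour-view (element i)
      ... | inj₁ (e , ci) = element i , trans ci (cong (_↑ˡ k) (rank-element e i refl))
      ... | inj₂ (ni , _) = ⊥-elim (true-and-false (element-holds i) ni)
      hits (inj₂ j) with uses-all j | colour-view (proj₁ (uses-all j))
      ... | v , nv , ev | inj₁ (e , _) = ⊥-elim (true-and-false e nv)
      ... | v , nv , ev | inj₂ (_ , cv) = v , trans cv (cong (s ↑ʳ_) ev)

      hit : ∀ y → ∃[ v ] colour v ≡ y
      hit y with hits (splitAt s y)
      ... | v , cv = v , trans cv (join-splitAt s k y)

      distinct : ∀ u v → u ~ v → colour u ≢ colour v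
      distinct u v u~v q with colour-view u | colour-view v
      ... | _ | inj₁ (ev , _) = ~-irrefl u~v (colour-alone ev q)
      ... | inj₁ (eu , _) | _ = ~-irrefl u~v (sym (colour-alone eu (sym q)))
      ... | inj₂ (nu , cu) | inj₂ (nv , cv) =
        proper u~v nu nv (↑ʳ-injective s _ _ (trans (sym cu) (trans q cv)))

      dominates : ∀ v → ∃[ i ] (∀ w → colour w ≡ i → v ~ w)
      dominates v with dominated v
      ... | inj₁ (p , sp , v~p) = colour p , λ w q → subst (v ~_) (sym (colour-alone sp q)) v~p
      ... | inj₂ (j , f) = s ↑ʳ j , class-j
        where
        class-j : ∀ w → colour w ≡ s ↑ʳ j → v ~ w
        class-j w q with colour-view w
        ... | inj₁ (_ , cw) = ⊥-elim (↑ˡ≢↑ʳ (trans (sym cw) q))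
        ... | inj₂ (nw , cw) = f w nw (↑ʳ-injective s _ _ (trans (sym cw) q))

module DiameterFour {n : ℕ} (G : Graph n) (acyclic : ¬ HasCycle G)
    (within-four : ∀ u v → ∃[ j ] (Dist G u v j × j ≤ 4))
    {a x₁ c x₂ b : Fin n}
    (a~x₁ : Adj G a x₁ ≡ true) (x₁~c : Adj G x₁ c ≡ true) (c~x₂ : Adj G c x₂ ≡ true) (x₂~b : Adj G x₂ b ≡ true)
    (a-b-far : ∀ j → Walk G a b j → 4 ≤ j) where
  open Walks G
  open Levels G acyclic c (λ v → proj₁ (within-four v c) , proj₁ (proj₂ (within-four v c)))
  open Supports G
  open Colourings G

  level-a : level a ≡ 2
  level-a = ≤-antisym (level-minimal (step a~x₁ (step x₁~c here)))
    (+-cancelʳ-≤ 2 2 (level a) (a-b-far _ (geodesic a ++ʷ step c~x₂ (step x₂~b here))))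

  level-b : level b ≡ 2
  level-b = ≤-antisym (level-minimal (step (~-sym x₂~b) (step (~-sym c~x₂) here)))
    (+-cancelˡ-≤ 2 2 (level b) (a-b-far _ (step a~x₁ (step x₁~c here) ++ʷ reverse (geodesic b))))

  level-x₁ : level x₁ ≡ 1
  level-x₁ = ≤-antisym (level-minimal (step x₁~c here))
    (≤-pred (subst (_≤ suc (level x₁)) level-a (level-step a~x₁)))

  level-x₂ : level x₂ ≡ 1
  level-x₂ = ≤-antisym (level-minimal (step (~-sym c~x₂) here))
    (≤-pred (subst (_≤ suc (level x₂)) level-b (level-step (~-sym x₂~b))))

  -- x₁ ≠ x₂, since otherwise a and b would be at distance 2.
  x₁≢x₂ : x₁ ≢ x₂
  x₁≢x₂ refl with a-b-far 2 (step a~x₁ (step x₂~b here))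
  ... | s≤s (s≤s ())

  -- Every level is at most 2: from a vertex w at level ≥ 3, the walks of length ≤ 4 to a and to b
  -- avoid c, so together they join x₁ to x₂ around c in the acyclic graph.
  level-≤2 : ∀ w → level w ≤ 2
  level-≤2 w with level w ≤? 2
  ... | yes ≤2 = ≤2
  ... | no ≰2 = ⊥-elim (joined (within-four w a) (within-four w b))
    where
    short-avoids : ∀ {z j} → level z ≡ 2 → (W : Walk G w z j) → j ≤ 4 → Along (c ≢_) W
    short-avoids {j = j} lz W j≤4 = avoids-root W
      (subst (λ t → j < level w + t) (sym lz) (<-≤-trans (s≤s j≤4) (+-monoˡ-≤ 2 (≰⇒> ≰2))))
    joined : ∃[ j ] (Dist G w a j × j ≤ 4) → ∃[ j ] (Dist G w b j × j ≤ 4) → ⊥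
    joined (_ , (Wa , _) , short-a) (_ , (Wb , _) , short-b) =
      no-detour acyclic (~-sym x₁~c) c~x₂ x₁≢x₂
        (step (~-sym a~x₁) (reverse Wa ++ʷ Wb ++ʷ step (~-sym x₂~b) here))
        (root-≢ level-x₁ ,
         along-++ (reverse Wa) _ (along-reverse Wa (short-avoids level-a Wa short-a))
           (along-++ Wb _ (short-avoids level-b Wb short-b) (root-≢ level-b , root-≢ level-x₂)))

  level-cases : ∀ v → level v ≡ 0 ⊎ level v ≡ 1 ⊎ level v ≡ 2
  level-cases v with level v | level-≤2 v
  ... | 0 | _ = inj₁ refl
  ... | 1 | _ = inj₂ (inj₁ refl)
  ... | 2 | _ = inj₂ (inj₂ refl)
  ... | suc (suc (suc _)) | s≤s (s≤s ())

  level-≢ : ∀ {u v} → u ~ v → level u ≢ level v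
  level-≢ u~v e with neighbour-level u~v
  ... | inj₁ lu = 1+n≢n (trans (sym lu) e)
  ... | inj₂ lv = 1+n≢n (trans (sym lv) (sym e))

  level-one⇒~c : ∀ {v} → level v ≡ 1 → v ~ c
  level-one⇒~c e with parent e
  ... | p , v~p , lp with level-zero lp
  ...   | refl = v~p

  ~c⇒level-one : ∀ {z} → c ~ z → level z ≡ 1
  ~c⇒level-one c~z with neighbour-level c~z
  ... | inj₁ e = ⊥-elim (0≢1+n (trans (sym level-root) e))
  ... | inj₂ e = trans e (cong suc level-root)

  level-two-neighbour : ∀ {w z} → level w ≡ 2 → w ~ z → level z ≡ 1
  level-two-neighbour {w} {z} e w~z with neighbour-level w~z | level-≤2 z
  ... | inj₁ e' | _ = suc-injective (trans (sym e') e)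
  ... | inj₂ e' | lz≤2 with subst (_≤ 2) (trans e' (cong suc e)) lz≤2
  ...   | s≤s (s≤s ())

  level-one-neighbour : ∀ {v z} → level v ≡ 1 → v ~ z → z ≡ c ⊎ level z ≡ 2
  level-one-neighbour e v~z with neighbour-level v~z
  ... | inj₁ e' = inj₁ (level-zero (suc-injective (trans (sym e') e)))
  ... | inj₂ e' = inj₂ (trans e' (cong suc e))

  centre-branching : 2 ≤ degree G c
  centre-branching = degree-≥2 (~-sym x₁~c) c~x₂ x₁≢x₂

  level-one-branching : ∀ {v w} → level v ≡ 1 → v ~ w → level w ≡ 2 → 2 ≤ degree G v
  level-one-branching e v~w lw = degree-≥2 (level-one⇒~c e) v~w (root-≢ lw)

  -- A level-two vertex is a leaf: all its neighbours are at level one, below it.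
  level-two-leaf : ∀ {w} → level w ≡ 2 → IsLeaf G w
  level-two-leaf {w} e with parent e
  ... | p , w~p , lp = only-neighbour⇒leaf w~p λ z w~z →
          low-neighbour-unique w~z w~p (below (level-two-neighbour e w~z)) (below lp)
    where
    below : ∀ {y} → level y ≡ 1 → level y ≤ level w
    below ly rewrite ly | e = s≤s z≤n

  -- Leaves lie at level 1 or 2, since c has degree ≥ 2.
  leaf-level : ∀ {v} → IsLeaf G v → level v ≡ 1 ⊎ level v ≡ 2
  leaf-level {v} leaf with level-cases v
  ... | inj₁ e with level-zero e
  ...   | refl = ⊥-elim (branching-not-leaf centre-branching leaf)
  leaf-level leaf | inj₂ levels = levels

  -- No two leaves are adjacent: one would be a level-one vertex with a child.
  leaves-nonadjacent : ∀ {u v} → IsLeaf G u → IsLeaf G v → ¬ u ~ v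
  leaves-nonadjacent lu lv u~v with leaf-level lu | leaf-level lv
  ... | inj₁ e | inj₁ e' = level-≢ u~v (trans e (sym e'))
  ... | inj₂ e | inj₂ e' = level-≢ u~v (trans e (sym e'))
  ... | inj₁ e | inj₂ e' = branching-not-leaf (level-one-branching e u~v e') lu
  ... | inj₂ e | inj₁ e' = branching-not-leaf (level-one-branching e' (~-sym u~v) e) lv

  -- The neighbour of a leaf is not a leaf, hence has degree > 1 and is a support vertex.
  leaf-neighbour-support : ∀ {l p} → IsLeaf G l → l ~ p → isSupport G p ≡ true
  leaf-neighbour-support leaf l~p = ⇒support
    (≤∧≢⇒< (degree-≥1 (~-sym l~p)) (λ e → leaves-nonadjacent leaf (sym e) l~p)) (~-sym l~p) leaf

  -- Every non-support vertex is c or a leaf: a level-one vertex other than a leaf has a child.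
  non-support-cases : ∀ {v} → isSupport G v ≡ false → v ≡ c ⊎ IsLeaf G v
  non-support-cases {v} nv with level-cases v
  ... | inj₁ e = inj₁ (level-zero e)
  ... | inj₂ (inj₂ e) = inj₂ (level-two-leaf e)
  ... | inj₂ (inj₁ e) = inj₂ (only-neighbour⇒leaf (level-one⇒~c e) only-c)
    where
    only-c : ∀ w → v ~ w → w ≡ c
    only-c w v~w with level-one-neighbour e v~w
    ... | inj₁ w≡c = w≡c
    ... | inj₂ lw = ⊥-elim (true-and-false
            (⇒support (level-one-branching e v~w lw) v~w (level-two-leaf lw)) nv)

  support-cases : ∀ {v} → isSupport G v ≡ true → v ≡ c ⊎ level v ≡ 1
  support-cases {v} sv with level-cases v
  ... | inj₁ e = inj₁ (level-zero e)
  ... | inj₂ (inj₁ e) = inj₂ e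
  ... | inj₂ (inj₂ e) = ⊥-elim (true-and-false sv (leaf-not-support (level-two-leaf e)))

  -- Off level one, every vertex has a support neighbour: c has x₁, a level-two leaf has its parent.
  support-neighbour : ∀ {v} → level v ≡ 0 ⊎ level v ≡ 2 → ∃[ p ] (isSupport G p ≡ true × v ~ p)
  support-neighbour (inj₁ e) with level-zero e
  ... | refl = x₁ , leaf-neighbour-support (level-two-leaf level-a) a~x₁ , ~-sym x₁~c
  support-neighbour (inj₂ e) with parent e
  ... | p , v~p , _ = p , leaf-neighbour-support (level-two-leaf e) v~p , v~p

  LeavesAtDistance3 : Set
  LeavesAtDistance3 = ∃[ u ] ∃[ u' ] (IsLeaf G u × IsLeaf G u' × Dist G u u' 3)

  -- Two leaves at distance 3 are not both at level two (their neighbours would be adjacent at level one),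
  -- so one of them hangs from c.
  far-leaves⇒centre-support : LeavesAtDistance3 → isSupport G c ≡ true
  far-leaves⇒centre-support (u , u' , lu , lu' , (W , _)) with leaf-level lu | leaf-level lu'
  ... | inj₁ e | _ = ⇒support centre-branching (~-sym (level-one⇒~c e)) lu
  ... | inj₂ _ | inj₁ e' = ⇒support centre-branching (~-sym (level-one⇒~c e')) lu'
  ... | inj₂ e | inj₂ e' with W
  ...   | step u~p (step p~q (step q~u' here)) = ⊥-elim (level-≢ p~q
          (trans (level-two-neighbour e u~p) (sym (level-two-neighbour e' (~-sym q~u')))))

  -- A leaf hanging from c is at distance 3 from a: every walk to a passes through c first.
  hanging-leaf-far : ∀ {l} → IsLeaf G l → c ~ l → ∀ j → Walk G l a j → 3 ≤ j
  hanging-leaf-far _ c~l _ here with trans (sym level-a) (~c⇒level-one c~l)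
  ... | ()
  hanging-leaf-far leaf c~l _ (step l~z W) with leaf-neighbour-unique leaf l~z (~-sym c~l)
  ... | refl = s≤s (subst (_≤ _) level-a (level-minimal (reverse W)))

  centre-support⇒far-leaves : isSupport G c ≡ true → LeavesAtDistance3
  centre-support⇒far-leaves sc with support⇒ sc
  ... | _ , l , c~l , leaf = l , a , leaf , level-two-leaf level-a ,
          (step (~-sym c~l) (step (~-sym x₁~c) (step (~-sym a~x₁) here)) , hanging-leaf-far leaf c~l)

  -- When c is a support vertex, all non-support vertices are pairwise non-adjacent leaves and every vertex
  -- has a support neighbour: one extra colour suffices, and a's colour class is an extra one.
  χ-support-centre : isSupport G c ≡ true → TDChromatic G (s + 1)
  χ-support-centre sc = Upper.construction (λ _ → zero) uses-all proper dominated , lower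
    where
    uses-all : ∀ j → ∃[ v ] (isSupport G v ≡ false × zero ≡ j)
    uses-all zero = a , leaf-not-support (level-two-leaf level-a) , refl
    uses-all (suc ())
    proper : ∀ {u v} → u ~ v → isSupport G u ≡ false → isSupport G v ≡ false → zero {0} ≢ zero
    proper u~v nu nv _ with non-support-cases nu | non-support-cases nv
    ... | inj₁ refl | _ = true-and-false sc nu
    ... | _ | inj₁ refl = true-and-false sc nv
    ... | inj₂ lu | inj₂ lv = leaves-nonadjacent lu lv u~v
    dominated : ∀ v → Dominated (λ _ → zero {0}) v
    dominated v with level-cases v
    ... | inj₁ e = inj₁ (support-neighbour (inj₁ e))
    ... | inj₂ (inj₁ e) = inj₁ (c , sc , level-one⇒~c e)
    ... | inj₂ (inj₂ e) = inj₁ (support-neighbour (inj₂ e))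
    lower : ∀ k → HasTDC G k → s + 1 ≤ k
    lower k (col , tdc) = lower-bound (λ _ → col a) (λ { {zero} {zero} _ → refl })
                                      (λ _ → non-support-free (leaf-not-support (level-two-leaf level-a)))
      where open Lower tdc

  centre-mark : Fin n → Fin 2
  centre-mark v with v ≟ c
  ... | yes _ = zero
  ... | no _ = suc zero

  centre-mark-c : centre-mark c ≡ zero
  centre-mark-c with c ≟ c
  ... | yes _ = refl
  ... | no c≢c = ⊥-elim (c≢c refl)

  centre-mark-other : ∀ {v} → v ≢ c → centre-mark v ≡ suc zero
  centre-mark-other {v} v≢c with v ≟ c
  ... | yes v≡c = ⊥-elim (v≢c v≡c)
  ... | no _ = refl

  centre-mark-zero : ∀ {v} → centre-mark v ≡ zero → v ≡ c
  centre-mark-zero {v} mark with v ≟ c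
  ... | yes v≡c = v≡c
  centre-mark-zero () | no _

  -- When c is not a support vertex, c gets a colour of its own, dominated by all level-one vertices.
  -- Conversely the classes dominated by x₁ and x₂ carry no support vertex, and together with a's class
  -- they provide two distinct free colours.
  χ-plain-centre : isSupport G c ≡ false → TDChromatic G (s + 2)
  χ-plain-centre nc = Upper.construction centre-mark uses-all proper dominated , lower
    where
    uses-all : ∀ j → ∃[ v ] (isSupport G v ≡ false × centre-mark v ≡ j)
    uses-all zero = c , nc , centre-mark-c
    uses-all (suc zero) = a , leaf-not-support (level-two-leaf level-a) ,
                          centre-mark-other (λ e → root-≢ level-a (sym e))
    proper : ∀ {u v} → u ~ v → isSupport G u ≡ false → isSupport G v ≡ false → centre-mark u ≢ centre-mark v
    proper u~v nu nv q with non-support-cases nu | non-support-cases nv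
    ... | inj₁ refl | _ = ~-irrefl u~v (sym (centre-mark-zero (trans (sym q) centre-mark-c)))
    ... | _ | inj₁ refl = ~-irrefl u~v (centre-mark-zero (trans q centre-mark-c))
    ... | inj₂ lu | inj₂ lv = leaves-nonadjacent lu lv u~v
    dominated : ∀ v → Dominated centre-mark v
    dominated v with level-cases v
    ... | inj₁ e = inj₁ (support-neighbour (inj₁ e))
    ... | inj₂ (inj₁ e) = inj₂ (zero , λ w _ mark → subst (v ~_) (sym (centre-mark-zero mark)) (level-one⇒~c e))
    ... | inj₂ (inj₂ e) = inj₁ (support-neighbour (inj₂ e))
    lower : ∀ k → HasTDC G k → s + 2 ≤ k
    lower k (col , tdc) = two-free (proj₂ (proj₂ tdc) x₁) (proj₂ (proj₂ tdc) x₂)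
      where
      open Lower tdc
      level-one-free : ∀ {x} i → level x ≡ 1 → (∀ w → col w ≡ i → x ~ w) → Free i
      level-one-free i lx dom v sv q with support-cases sv
      ... | inj₁ refl = true-and-false sv nc
      ... | inj₂ lv = level-≢ (dom v (sym q)) (trans lx (sym lv))
      two-free : ∃[ i ] (∀ w → col w ≡ i → x₁ ~ w) → ∃[ i ] (∀ w → col w ≡ i → x₂ ~ w) → s + 2 ≤ k
      two-free (A , dom₁) (B , dom₂) with A ≟ col a
      ... | no A≢a = lower-bound (pair A (col a)) (pair-injective A≢a)
        λ { zero → level-one-free A level-x₁ dom₁
          ; (suc zero) → non-support-free (leaf-not-support (level-two-leaf level-a)) }
      ... | yes A≡a = lower-bound (pair A B) (pair-injective A≢B)
        λ { zero → level-one-free A level-x₁ dom₁ ; (suc zero) → level-one-free B level-x₂ dom₂ }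
        where
        A≢B : A ≢ B
        A≢B A≡B = x₁≢x₂ (leaf-neighbour-unique (level-two-leaf level-a) a~x₁
                           (~-sym (dom₂ a (trans (sym A≡a) A≡B))))

  centre-plain : ¬ LeavesAtDistance3 → isSupport G c ≡ false
  centre-plain no-far with isSupport G c in e
  ... | true = ⊥-elim (no-far (centre-support⇒far-leaves e))
  ... | false = refl

proposition6p6 : ∀ {n : ℕ} (T : Graph n) → IsTree T → Diam T 4 →
    ((∃[ u ] ∃[ u' ] (IsLeaf T u × IsLeaf T u' × Dist T u u' 3)) →
    TDChromatic T (supportCount T + 1))
    × ((¬ (∃[ u ] ∃[ u' ] (IsLeaf T u × IsLeaf T u' × Dist T u u' 3))) →
    TDChromatic T (supportCount T + 2))
proposition6p6 T (_ , acyclic)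
               (within-four , (_ , _ , (step a~x₁ (step x₁~c (step c~x₂ (step x₂~b here))) , a-b-far))) =
  (λ far → χ-support-centre (far-leaves⇒centre-support far)) ,
  (λ no-far → χ-plain-centre (centre-plain no-far))
  where open DiameterFour T acyclic within-four a~x₁ x₁~c c~x₂ x₂~b a-b-far
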